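{- For all $B_1,B_2\in\mathrm{Bic}(T)$, one has $B_1\wedge B_2=(B_1^c\vee B_2^c)^c$, where $X^c=\mathrm{Seg}(T)\setminus X$ and $\vee,\wedge$ denote join and meet in the lattice $\mathrm{Bic}(T)$.
   Context: Let $T$ be a finite tree embedded in a disk so that exactly its leaves lie on the boundary, with every non-leaf vertex of degree at least $3$; the embedding gives a cyclic order of edges at each vertex. A segment is an acyclic path $(v_1,\dots,v_n)$, $n\ge2$, of pairwise distinct consecutive-adjacent vertices such that for each $1\le j\le n-2$ the edge $\{v_{j+1},v_{j+2}\}$ is immediately clockwise or counterclockwise from $\{v_j,v_{j+1}\}$ at $v_{j+1}$; $\mathrm{Seg}(T)$ is the set of segments. For segments $s_1=(v_1,\dots,v_k)$, $s_2=(v_k,\dots,v_n)$ sharing only $v_k$, $s_1\circ s_2=(v_1,\dots,v_n)$; they are composable if this is a segment. $B\subseteq\mathrm{Seg}(T)$ is closed if it contains $s_1\circ s_2$ for all composable $s_1,s_2\in B$, biclosed if $B$ and its complement are closed. $\mathrm{Bic}(T)$ is the set of biclosed sets ordered by inclusion; it is known to be a lattice, with $B_1\vee B_2$ equal to the smallest closed set containing $B_1\cup B_2$. -}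

module Defs where

open import Data.Nat using (ℕ; suc; _≥_)
open import Data.Fin using (Fin)
open import Data.Bool using (Bool; true; false; not)
open import Data.List using (List; []; _∷_; _++_; _∷ʳ_; length; [_])
open import Data.List.Membership.Propositional using (_∈_; _∉_)
open import Data.List.Relation.Unary.Unique.Propositional using (Unique)
open import Data.Product using (Σ; ∃; ∃-syntax; _×_; _,_)
open import Data.Sum using (_⊎_)
open import Relation.Binary.PropositionalEquality using (_≡_)
open import Relation.Nullary using (¬_)

-- Cyclic orders given as lists: b immediately follows a (cyclically) in L.

CycSucc : {A : Set} → List A → A → A → Set
CycSucc L a b =
  (∃[ xs ] ∃[ ys ] L ≡ xs ++ a ∷ b ∷ ys) ⊎ (∃[ xs ] L ≡ b ∷ (xs ++ [ a ]))

data Walk {n : ℕ} (Adj : Fin n → Fin n → Set) : List (Fin n) → Set where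
  w-nil  : Walk Adj []
  w-one  : ∀ v → Walk Adj (v ∷ [])
  w-cons : ∀ u v vs → Adj u v → Walk Adj (v ∷ vs) → Walk Adj (u ∷ v ∷ vs)

last? : {A : Set} → List A → List A
last? [] = []
last? (x ∷ []) = x ∷ []
last? (x ∷ y ∷ ys) = last? (y ∷ ys)

-- A plane tree: a finite tree on vertex set Fin n together with a rotation
-- system (the clockwise cyclic order of neighbours at each vertex), which is
-- exactly the combinatorial data of an embedding in a disk with the leaves
-- on the boundary.

record PlaneTree (n : ℕ) : Set where
  field
    nbrs      : Fin n → List (Fin n)
    nbrs-uniq : ∀ v → Unique (nbrs v)
    irrefl    : ∀ v → v ∉ nbrs v
    symm      : ∀ u v → v ∈ nbrs u → u ∈ nbrs v
  Adj : Fin n → Fin n → Set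
  Adj u v = v ∈ nbrs u
  field
    connected : ∀ u v → ∃[ ws ] (Walk Adj (u ∷ ws) × last? (u ∷ ws) ≡ v ∷ [])
    -- no cycle (u , xs.. , v , u) with at least 3 distinct vertices
    acyclic   : ∀ u xs v → length xs ≥ 1 → Unique (u ∷ xs ++ [ v ]) →
                Walk Adj (u ∷ xs ++ [ v ]) → ¬ Adj v u
    degree    : ∀ v → length (nbrs v) ≡ 1 ⊎ length (nbrs v) ≥ 3

open PlaneTree public

-- Turn condition at the middle vertex v of (u , v , w): the edge {v,w} is
-- immediately clockwise or counterclockwise from {u,v} at v.
Turn : ∀ {n} → PlaneTree n → Fin n → Fin n → Fin n → Set
Turn T u v w = CycSucc (nbrs T v) u w ⊎ CycSucc (nbrs T v) w u

data Turns {n : ℕ} (T : PlaneTree n) : List (Fin n) → Set where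
  t-nil  : Turns T []
  t-one  : ∀ v → Turns T (v ∷ [])
  t-two  : ∀ u v → Turns T (u ∷ v ∷ [])
  t-cons : ∀ u v w ws → Turn T u v w → Turns T (v ∷ w ∷ ws) → Turns T (u ∷ v ∷ w ∷ ws)

IsSeg : ∀ {n} → PlaneTree n → List (Fin n) → Set
IsSeg T s = length s ≥ 2 × Unique s × Walk (Adj T) s × Turns T s

-- Sets of segments: a Boolean predicate on vertex lists; only its values on
-- segments matter (membership of a segment s is  X s ≡ true).

SegSet : ℕ → Set
SegSet n = List (Fin n) → Bool

_ᶜ : ∀ {n} → SegSet n → SegSet n
(X ᶜ) s = not (X s)

Sub : ∀ {n} → PlaneTree n → SegSet n → SegSet n → Set
Sub T X Y = ∀ s → IsSeg T s → X s ≡ true → Y s ≡ true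

-- closed: for composable segments s₁ = (xs, v) and s₂ = (v, ys) in X, the
-- composite s₁ ∘ s₂ = (xs, v, ys) is in X. (That the composite is a segment
-- forces s₁ and s₂ to share only v.)
Closed : ∀ {n} → PlaneTree n → SegSet n → Set
Closed T X = ∀ xs v ys →
  IsSeg T (xs ++ [ v ]) → IsSeg T (v ∷ ys) → IsSeg T (xs ++ v ∷ ys) →
  X (xs ++ [ v ]) ≡ true → X (v ∷ ys) ≡ true → X (xs ++ v ∷ ys) ≡ true

Biclosed : ∀ {n} → PlaneTree n → SegSet n → Set
Biclosed T X = Closed T X × Closed T (X ᶜ)

IsJoin : ∀ {n} → PlaneTree n → SegSet n → SegSet n → SegSet n → Set
IsJoin T X Y J = Biclosed T J × Sub T X J × Sub T Y J ×
  (∀ K → Biclosed T K → Sub T X K → Sub T Y K → Sub T J K)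

IsMeet : ∀ {n} → PlaneTree n → SegSet n → SegSet n → SegSet n → Set
IsMeet T X Y M = Biclosed T M × Sub T M X × Sub T M Y ×
  (∀ K → Biclosed T K → Sub T K X → Sub T K Y → Sub T K M)

module Submission where

-- Complementation X ↦ Xᶜ is an order-reversing involution on sets of
-- segments that preserves biclosedness; hence it exchanges joins and meets
-- in Bic(T), and B₁ ∧ B₂ = (B₁ᶜ ∨ B₂ᶜ)ᶜ.

open import Defs
open import Data.Nat using (ℕ)
open import Data.Bool using (Bool; true; false; not)
open import Data.Bool.Properties using (not-involutive)
open import Data.Product using (_,_)
open import Data.List using (List)
open import Data.Fin using (Fin)
open import Relation.Binary.PropositionalEquality using (_≡_; refl; trans; sym)

not-contrapositive : ∀ {b₁ b₂ : Bool} →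
  (b₁ ≡ true → b₂ ≡ true) → not b₂ ≡ true → not b₁ ≡ true
not-contrapositive {false} _  _ = refl
not-contrapositive {true} {true}  _ ()
not-contrapositive {true} {false} b₁⇒b₂ _ with () ← b₁⇒b₂ refl

module _ {n : ℕ} (T : PlaneTree n) where

  ᶜᶜ-elim : (X : SegSet n) (s : List (Fin n)) → (X ᶜ ᶜ) s ≡ true → X s ≡ true
  ᶜᶜ-elim X s = trans (sym (not-involutive (X s)))

  ᶜᶜ-intro : (X : SegSet n) (s : List (Fin n)) → X s ≡ true → (X ᶜ ᶜ) s ≡ true
  ᶜᶜ-intro X s = trans (not-involutive (X s))

  Closed-ᶜᶜ : (X : SegSet n) → Closed T X → Closed T (X ᶜ ᶜ)
  Closed-ᶜᶜ X closed xs v ys seg₁ seg₂ seg₁₂ in₁ in₂ =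
    ᶜᶜ-intro X _ (closed xs v ys seg₁ seg₂ seg₁₂ (ᶜᶜ-elim X _ in₁) (ᶜᶜ-elim X _ in₂))

  Biclosed-ᶜ : (X : SegSet n) → Biclosed T X → Biclosed T (X ᶜ)
  Biclosed-ᶜ X (closed , closedᶜ) = closedᶜ , Closed-ᶜᶜ X closed

  ⊆-ᶜ : (X Y : SegSet n) → Sub T X Y → Sub T (Y ᶜ) (X ᶜ)
  ⊆-ᶜ X Y X⊆Y s seg = not-contrapositive (X⊆Y s seg)

  ᶜ-⊆ : (X Y : SegSet n) → Sub T (X ᶜ) Y → Sub T (Y ᶜ) X
  ᶜ-⊆ X Y Xᶜ⊆Y s seg inYᶜ = ᶜᶜ-elim X s (⊆-ᶜ (X ᶜ) Y Xᶜ⊆Y s seg inYᶜ)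

  ⊆-ᶜ′ : (X Y : SegSet n) → Sub T X (Y ᶜ) → Sub T Y (X ᶜ)
  ⊆-ᶜ′ X Y X⊆Yᶜ s seg inY = ⊆-ᶜ X (Y ᶜ) X⊆Yᶜ s seg (ᶜᶜ-intro Y s inY)

lemma2p10 : ∀ {n : ℕ} (T : PlaneTree n) (B₁ B₂ J : SegSet n) →
    Biclosed T B₁ → Biclosed T B₂ →
    IsJoin T (B₁ ᶜ) (B₂ ᶜ) J →
    IsMeet T B₁ B₂ (J ᶜ)
lemma2p10 T B₁ B₂ J _ _ (J-biclosed , B₁ᶜ⊆J , B₂ᶜ⊆J , J-least) =
  Biclosed-ᶜ T J J-biclosed , ᶜ-⊆ T B₁ J B₁ᶜ⊆J , ᶜ-⊆ T B₂ J B₂ᶜ⊆J , Jᶜ-greatest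
  where
  -- A biclosed lower bound K of B₁, B₂ has Kᶜ a biclosed upper bound of
  -- B₁ᶜ, B₂ᶜ; leastness of J gives J ⊆ Kᶜ, i.e. K ⊆ Jᶜ.
  Jᶜ-greatest : ∀ K → Biclosed T K → Sub T K B₁ → Sub T K B₂ → Sub T K (J ᶜ)
  Jᶜ-greatest K K-biclosed K⊆B₁ K⊆B₂ =
    ⊆-ᶜ′ T J K (J-least (K ᶜ) (Biclosed-ᶜ T K K-biclosed) (⊆-ᶜ T K B₁ K⊆B₁) (⊆-ᶜ T K B₂ K⊆B₂))
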